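{- Let $A$ be an FDDS and $k \ge 1$ an integer. The monomial $X \mapsto A X^k$ on FDDS is injective (i.e. $AX^k = AY^k$ implies $X=Y$ for all FDDS $X,Y$) if and only if $A$ is cancelable.
   Context: An FDDS is a pair $(S,f)$ with $S$ a finite (possibly empty) set and $f:S\to S$, up to isomorphism; sum is disjoint union and product is the direct product $(S,f)\times(T,g)=(S\times T,(s,t)\mapsto(f(s),g(t)))$. An FDDS $A$ is cancelable if $AB=AC$ implies $B=C$ for all FDDS $B,C$ (equivalently, some connected component of $A$ contains a fixed point). -}

module Defs where

open import Data.Nat using (ℕ; zero; suc; _+_; _*_)
open import Data.Fin using (Fin; combine; remQuot; join; splitAt)
open import Data.Product using (_×_; _,_; proj₁; proj₂; uncurry)
open import Data.Sum using (_⊎_; inj₁; inj₂; [_,_]′)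
open import Function using (_∘_; id)
open import Relation.Binary.PropositionalEquality using (_≡_)

record FDDS : Set where
  constructor mkFDDS
  field
    size : ℕ
    map  : Fin size → Fin size
open FDDS public

record _≅_ (A B : FDDS) : Set where
  field
    to      : Fin (size A) → Fin (size B)
    from    : Fin (size B) → Fin (size A)
    from∘to : ∀ x → from (to x) ≡ x
    to∘from : ∀ y → to (from y) ≡ y
    commute : ∀ x → to (map A x) ≡ map B (to x)

_⊕_ : FDDS → FDDS → FDDS
A ⊕ B = mkFDDS (size A + size B)
  (join (size A) (size B) ∘ [ inj₁ ∘ map A , inj₂ ∘ map B ]′ ∘ splitAt (size A))

-- Product: direct product, with Fin (m * n) ≅ Fin m × Fin n via combine/remQuot.
_⊗_ : FDDS → FDDS → FDDS
A ⊗ B = mkFDDS (size A * size B)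
  (λ z → let p = remQuot (size B) z in combine (map A (proj₁ p)) (map B (proj₂ p)))

𝟙 : FDDS
𝟙 = mkFDDS 1 id

_^_ : FDDS → ℕ → FDDS
X ^ zero  = 𝟙
X ^ suc k = X ⊗ (X ^ k)

Cancelable : FDDS → Set
Cancelable A = ∀ (B C : FDDS) → (A ⊗ B) ≅ (A ⊗ C) → B ≅ C

module Submission where

-- Lovász's counting argument: an FDDS X is determined up to isomorphism by the numbers
-- hom(D, X) of homomorphisms D → X, D ranging over all FDDS.  Sorting homomorphisms by
-- their kernel gives hom(D, X) = Σ_θ inj(D/θ, X) over the congruences θ of D, so by
-- induction on |D| the numbers inj(D, X) of injective homomorphisms are determined too;
-- then X and Y embed into each other and are isomorphic.  As hom(D, -) turns ⊗ into
-- multiplication, for cancelable A an isomorphism A X^k ≅ A Y^k gives X^k ≅ Y^k, hence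
-- hom(D, X)^k = hom(D, Y)^k and X ≅ Y.  Conversely A B ≅ A C gives
-- hom(D, A) hom(D, B) = hom(D, A) hom(D, C), hence A B^k ≅ A C^k, and an injective
-- monomial then yields B ≅ C.

open import Defs
open import Data.Bool.Base using (if_then_else_)
open import Data.Empty using (⊥-elim; ⊥-elim-irr)
open import Data.Fin.Base
  using (Fin; zero; suc; _↑ˡ_; _↑ʳ_; combine; remQuot; fromℕ<; punchIn; punchOut)
  renaming (_≤_ to _≤ᶠ_)
open import Data.Fin.Properties
  using (_≟_; all?; any?; ∀-cons; toℕ<n; *↔×; remQuot-combine; combine-remQuot; injective⇒≤;
         punchInᵢ≢i; punchOut-injective)
  renaming (≤-antisym to ≤ᶠ-antisym; ≤-trans to ≤ᶠ-trans; ≤-reflexive to ≤ᶠ-reflexive)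
open import Data.Nat.Base as ℕ
  using (ℕ; zero; suc; _+_; _*_; _≤_; _<_; _≥_; z≤n; s≤s; NonZero; >-nonZero)
open import Data.Nat.Induction using (<-wellFounded)
open import Data.Nat.Properties
  using (+-*-semiring; ≤-antisym; ≤-trans; ≤-<-trans; m≤n⇒m≤1+n; 1+n≰n; n≢0⇒n>0; <-cmp;
         <⇒≢; +-assoc; +-cancelʳ-≡; *-identityʳ; *-cancelˡ-≡; ^-zeroˡ; ^-monoˡ-<)
  renaming (_≟_ to _≟ℕ_)
open import Algebra.Properties.Semiring.Sum +-*-semiring
  using (sum; sum-syntax; sum-cong-≗; sum-replicate-zero; sum-remove; ∑-comm;
         *-distribˡ-sum; *-distribʳ-sum)
open import Data.Product.Base as Σ using (Σ; ∃; _×_; _,_; proj₁; proj₂; uncurry)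
open import Data.Product.Function.NonDependent.Propositional using (_×-↔_)
open import Data.Vec.Base as Vec using (Vec; []; _∷_; head; tail; lookup; tabulate; allFin)
open import Data.Vec.Properties
  using (lookup-map; lookup-zipWith; lookup∘tabulate; lookup-allFin; map-∘; map-cong; map-id;
         tabulate∘lookup; tabulate-cong)
open import Function.Base using (_∘_; id)
open import Function.Bundles using (_↔_; Inverse; mk↔ₛ′)
open import Function.Definitions using (Injective)
open import Function.Properties.Inverse using (↔-refl; ↔-trans)
open import Induction.WellFounded using (Acc; acc)
open import Level using (0ℓ)
open import Relation.Binary.Definitions using (tri<; tri≈; tri>)
open import Relation.Binary.PropositionalEquality
open import Relation.Nullary.Decidable using (Dec; yes; no; does; map′; _×-dec_)
open import Relation.Nullary.Negation using (¬_; contradiction)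
open import Relation.Unary using (Pred; Decidable; _≐_; _∩_)
open import Relation.Unary.Properties using (_∩?_; _×?_)

private
  variable
    A B : Set
    N M K n x : ℕ

-- Counting decidable predicates on Fin N

indicator : Dec A → ℕ
indicator d = if does d then 1 else 0

count : {P : Pred (Fin N) 0ℓ} → Decidable P → ℕ
count {N} P? = ∑[ i < N ] indicator (P? i)

element : {P : Pred (Fin N) 0ℓ} (P? : Decidable P) → Fin (count P?) → Σ (Fin N) P
element {suc N} P? j with P? zero
element P? zero    | yes p = zero , p
element P? (suc j) | yes _ = Σ.map suc id (element (P? ∘ suc) j)
element P? j       | no  _ = Σ.map suc id (element (P? ∘ suc) j)

index : {P : Pred (Fin N) 0ℓ} (P? : Decidable P) (i : Fin N) → .(P i) → Fin (count P?)
index {suc N} P? i p with P? zero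
index P? zero    p | yes _  = zero
index P? (suc i) p | yes _  = suc (index (P? ∘ suc) i p)
index P? zero    p | no ¬p₀ = ⊥-elim-irr (¬p₀ p)
index P? (suc i) p | no _   = index (P? ∘ suc) i p

element-index : {P : Pred (Fin N) 0ℓ} (P? : Decidable P) (i : Fin N) .(p : P i) →
                proj₁ (element P? (index P? i p)) ≡ i
element-index {suc N} P? i p with P? zero
element-index P? zero    p | yes _  = refl
element-index P? (suc i) p | yes _  = cong suc (element-index (P? ∘ suc) i p)
element-index P? zero    p | no ¬p₀ = ⊥-elim-irr (¬p₀ p)
element-index P? (suc i) p | no _   = cong suc (element-index (P? ∘ suc) i p)

index-element : {P : Pred (Fin N) 0ℓ} (P? : Decidable P) (j : Fin (count P?)) →
                index P? (proj₁ (element P? j)) (proj₂ (element P? j)) ≡ j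
index-element {suc N} P? j with P? zero
index-element P? zero    | yes _ = refl
index-element P? (suc j) | yes _ = cong suc (index-element (P? ∘ suc) j)
index-element P? j       | no  _ = index-element (P? ∘ suc) j

index-cong : {P : Pred (Fin N) 0ℓ} (P? : Decidable P) {i i′ : Fin N} .{p : P i} .{p′ : P i′} →
             i ≡ i′ → index P? i p ≡ index P? i′ p′
index-cong P? refl = refl

count-≤ : {P : Pred (Fin N) 0ℓ} {Q : Pred (Fin M) 0ℓ} (P? : Decidable P) (Q? : Decidable Q)
          (φ : Fin N → Fin M) → (∀ {i} → P i → Q (φ i)) →
          (∀ {i i′} → P i → P i′ → φ i ≡ φ i′ → i ≡ i′) → count P? ≤ count Q?
count-≤ {N} {P = P} P? Q? φ φ-∈ φ-injective = injective⇒≤ f-injective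
  where
  open ≡-Reasoning
  a : Fin (count P?) → Fin N
  a = proj₁ ∘ element P?
  a-∈ : ∀ j → P (a j)
  a-∈ = proj₂ ∘ element P?
  f : Fin (count P?) → Fin (count Q?)
  f j = index Q? (φ (a j)) (φ-∈ (a-∈ j))
  f-injective : Injective _≡_ _≡_ f
  f-injective {j} {j′} fj≡fj′ = begin
    j                        ≡⟨ index-element P? j ⟨
    index P? (a j) (a-∈ j)   ≡⟨ index-cong P? (φ-injective (a-∈ j) (a-∈ j′) φa≡φa′) ⟩
    index P? (a j′) (a-∈ j′) ≡⟨ index-element P? j′ ⟩
    j′                       ∎
    where
    φa≡φa′ : φ (a j) ≡ φ (a j′)
    φa≡φa′ = begin
      φ (a j)                   ≡⟨ element-index Q? _ _ ⟨
      proj₁ (element Q? (f j))  ≡⟨ cong (proj₁ ∘ element Q?) fj≡fj′ ⟩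
      proj₁ (element Q? (f j′)) ≡⟨ element-index Q? _ _ ⟩
      φ (a j′)                  ∎

-- A bijection between the extensions of P and Q, stated without Σ-types so that P and Q
-- need not be proof-irrelevant.
record _↔ₚ_ {A B : Set} (P : Pred A 0ℓ) (Q : Pred B 0ℓ) : Set where
  field
    to      : A → B
    from    : B → A
    to-∈    : ∀ {a} → P a → Q (to a)
    from-∈  : ∀ {b} → Q b → P (from b)
    from∘to : ∀ {a} → P a → from (to a) ≡ a
    to∘from : ∀ {b} → Q b → to (from b) ≡ b

  to-injective : ∀ {a a′} → P a → P a′ → to a ≡ to a′ → a ≡ a′
  to-injective p p′ e = trans (sym (from∘to p)) (trans (cong from e) (from∘to p′))

↔ₚ-sym : {P : Pred A 0ℓ} {Q : Pred B 0ℓ} → P ↔ₚ Q → Q ↔ₚ P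
↔ₚ-sym ρ = record
  { to = from ; from = to ; to-∈ = from-∈ ; from-∈ = to-∈
  ; from∘to = to∘from ; to∘from = from∘to
  }
  where open _↔ₚ_ ρ

↔ₚ-trans : {C : Set} {P : Pred A 0ℓ} {Q : Pred B 0ℓ} {R : Pred C 0ℓ} →
           P ↔ₚ Q → Q ↔ₚ R → P ↔ₚ R
↔ₚ-trans ρ σ = record
  { to      = σ.to ∘ ρ.to
  ; from    = ρ.from ∘ σ.from
  ; to-∈    = σ.to-∈ ∘ ρ.to-∈
  ; from-∈  = ρ.from-∈ ∘ σ.from-∈
  ; from∘to = λ p → trans (cong ρ.from (σ.from∘to (ρ.to-∈ p))) (ρ.from∘to p)
  ; to∘from = λ r → trans (cong σ.to (ρ.to∘from (σ.from-∈ r))) (σ.to∘from r)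
  }
  where
  module ρ = _↔ₚ_ ρ
  module σ = _↔ₚ_ σ

≐⇒↔ₚ : {P Q : Pred A 0ℓ} → P ≐ Q → P ↔ₚ Q
≐⇒↔ₚ (P⊆Q , Q⊆P) = record
  { to = id ; from = id ; to-∈ = P⊆Q ; from-∈ = Q⊆P
  ; from∘to = λ _ → refl ; to∘from = λ _ → refl
  }

count-↔ₚ : {P : Pred (Fin N) 0ℓ} {Q : Pred (Fin M) 0ℓ} (P? : Decidable P) (Q? : Decidable Q) →
           P ↔ₚ Q → count P? ≡ count Q?
count-↔ₚ P? Q? ρ =
  ≤-antisym (count-≤ P? Q? to to-∈ to-injective) (count-≤ Q? P? from from-∈ from-injective)
  where
  open _↔ₚ_ ρ
  open _↔ₚ_ (↔ₚ-sym ρ) using () renaming (to-injective to from-injective)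

sum-↑ : ∀ M {L} (f : Fin (M + L) → ℕ) →
        sum f ≡ ∑[ j < M ] f (j ↑ˡ L) + ∑[ z < L ] f (M ↑ʳ z)
sum-↑ zero    f = refl
sum-↑ (suc M) f = trans (cong (f zero +_) (sum-↑ M (f ∘ suc))) (sym (+-assoc (f zero) _ _))

sum-combine : ∀ N {M} (f : Fin (N * M) → ℕ) → sum f ≡ ∑[ i < N ] ∑[ j < M ] f (combine i j)
sum-combine zero        f = refl
sum-combine (suc N) {M} f =
  trans (sum-↑ M f) (cong (sum (λ j → f (j ↑ˡ N * M)) +_) (sum-combine N (f ∘ (M ↑ʳ_))))

sum-cancel-except : (f g : Fin K → ℕ) (c : Fin K) → (∀ d → d ≢ c → f d ≡ g d) →
                    sum f ≡ sum g → f c ≡ g c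
sum-cancel-except {suc K} f g c f≡g ∑f≡∑g = +-cancelʳ-≡ _ (f c) (g c) (begin
  f c + sum (f ∘ punchIn c) ≡⟨ sum-remove f ⟨
  sum f                     ≡⟨ ∑f≡∑g ⟩
  sum g                     ≡⟨ sum-remove g ⟩
  g c + sum (g ∘ punchIn c) ≡⟨ cong (g c +_) (sum-cong-≗ λ d → f≡g (punchIn c d) (punchInᵢ≢i c d)) ⟨
  g c + sum (f ∘ punchIn c) ∎)
  where open ≡-Reasoning

indicator-×-dec : (a : Dec A) (b : Dec B) → indicator (a ×-dec b) ≡ indicator a * indicator b
indicator-×-dec (yes _) (yes _) = refl
indicator-×-dec (yes _) (no _)  = refl
indicator-×-dec (no _)  _       = refl

sum-indicator-≟ : (k : Fin K) → ∑[ c < K ] indicator (k ≟ c) ≡ 1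
sum-indicator-≟ {suc K} zero    = cong suc (sum-replicate-zero K)
sum-indicator-≟ {suc K} (suc k) = sum-indicator-≟ k

count-× : {P : Pred (Fin N) 0ℓ} {Q : Pred (Fin M) 0ℓ} (P? : Decidable P) (Q? : Decidable Q) →
          count ((P? ×? Q?) ∘ remQuot M) ≡ count P? * count Q?
count-× {N} {M} P? Q? = begin
  count ((P? ×? Q?) ∘ remQuot M)
    ≡⟨ sum-combine N _ ⟩
  ∑[ i < N ] ∑[ j < M ] indicator ((P? ×? Q?) (remQuot M (combine i j)))
    ≡⟨ sum-cong-≗ (λ i → sum-cong-≗ λ j → cong (indicator ∘ (P? ×? Q?)) (remQuot-combine i j)) ⟩
  ∑[ i < N ] ∑[ j < M ] indicator (P? i ×-dec Q? j)
    ≡⟨ sum-cong-≗ (λ i → sum-cong-≗ (λ j → indicator-×-dec (P? i) (Q? j))) ⟩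
  ∑[ i < N ] ∑[ j < M ] (indicator (P? i) * indicator (Q? j))
    ≡⟨ sum-cong-≗ (λ i → *-distribˡ-sum (indicator (P? i)) (indicator ∘ Q?)) ⟨
  ∑[ i < N ] (indicator (P? i) * count Q?)
    ≡⟨ *-distribʳ-sum (count Q?) (indicator ∘ P?) ⟨
  count P? * count Q?
    ∎
  where open ≡-Reasoning

count-partition : {P : Pred (Fin N) 0ℓ} (P? : Decidable P) (key : Fin N → Fin K) →
                  count P? ≡ ∑[ c < K ] count (λ i → P? i ×-dec key i ≟ c)
count-partition {N} {K} P? key = begin
  ∑[ i < N ] indicator (P? i)
    ≡⟨ sum-cong-≗ fibres ⟨
  ∑[ i < N ] ∑[ c < K ] indicator (P? i ×-dec key i ≟ c)
    ≡⟨ ∑-comm (λ i c → indicator (P? i ×-dec key i ≟ c)) ⟩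
  ∑[ c < K ] ∑[ i < N ] indicator (P? i ×-dec key i ≟ c)
    ∎
  where
  open ≡-Reasoning
  fibres : ∀ i → ∑[ c < K ] indicator (P? i ×-dec key i ≟ c) ≡ indicator (P? i)
  fibres i = begin
    ∑[ c < K ] indicator (P? i ×-dec key i ≟ c)
      ≡⟨ sum-cong-≗ (λ c → indicator-×-dec (P? i) (key i ≟ c)) ⟩
    ∑[ c < K ] (indicator (P? i) * indicator (key i ≟ c))
      ≡⟨ *-distribˡ-sum (indicator (P? i)) (indicator ∘ (key i ≟_)) ⟨
    indicator (P? i) * ∑[ c < K ] indicator (key i ≟ c)
      ≡⟨ cong (indicator (P? i) *_) (sum-indicator-≟ (key i)) ⟩
    indicator (P? i) * 1
      ≡⟨ *-identityʳ _ ⟩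
    indicator (P? i)
      ∎

∈⇒count-pos : {P : Pred (Fin N) 0ℓ} (P? : Decidable P) {i : Fin N} → P i → 0 < count P?
∈⇒count-pos P? {i} p = ≤-<-trans z≤n (toℕ<n (index P? i p))

count-pos⇒∃ : {P : Pred (Fin N) 0ℓ} (P? : Decidable P) → 0 < count P? → ∃ P
count-pos⇒∃ P? pos = element P? (fromℕ< pos)

count-all : {P : Pred (Fin N) 0ℓ} (P? : Decidable P) → (∀ i → P i) → count P? ≡ N
count-all {zero}  P? all = refl
count-all {suc N} P? all with P? zero
... | yes _  = cong suc (count-all (P? ∘ suc) (all ∘ suc))
... | no ¬p₀ = ⊥-elim (¬p₀ (all zero))

count≤N : {P : Pred (Fin N) 0ℓ} (P? : Decidable P) → count P? ≤ N
count≤N {zero}  P? = z≤n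
count≤N {suc N} P? with P? zero
... | yes _ = s≤s (count≤N (P? ∘ suc))
... | no _  = m≤n⇒m≤1+n (count≤N (P? ∘ suc))

¬∀⇒count<N : {P : Pred (Fin N) 0ℓ} (P? : Decidable P) → ¬ (∀ i → P i) → count P? < N
¬∀⇒count<N {zero}  P? ¬all = ⊥-elim (¬all λ ())
¬∀⇒count<N {suc N} P? ¬all with P? zero
... | yes p₀ = s≤s (¬∀⇒count<N (P? ∘ suc) (¬all ∘ ∀-cons p₀))
... | no _   = s≤s (count≤N (P? ∘ suc))

countIn : Fin N ↔ A → {P : Pred A 0ℓ} → Decidable P → ℕ
countIn e P? = count (P? ∘ Inverse.to e)

enumeration-↔ₚ : (e : Fin N ↔ A) {P : Pred A 0ℓ} → (P ∘ Inverse.to e) ↔ₚ P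
enumeration-↔ₚ e {P} = record
  { to      = to
  ; from    = from
  ; to-∈    = id
  ; from-∈  = λ {a} p → subst P (sym (strictlyInverseˡ a)) p
  ; from∘to = λ {i} _ → strictlyInverseʳ i
  ; to∘from = λ {a} _ → strictlyInverseˡ a
  }
  where open Inverse e

countIn-↔ₚ : {P : Pred A 0ℓ} {Q : Pred B 0ℓ} (e : Fin N ↔ A) (e′ : Fin M ↔ B)
             (P? : Decidable P) (Q? : Decidable Q) → P ↔ₚ Q → countIn e P? ≡ countIn e′ Q?
countIn-↔ₚ e e′ P? Q? ρ = count-↔ₚ (P? ∘ Inverse.to e) (Q? ∘ Inverse.to e′)
  (↔ₚ-trans (enumeration-↔ₚ e) (↔ₚ-trans ρ (↔ₚ-sym (enumeration-↔ₚ e′))))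

_×ᵉ_ : Fin N ↔ A → Fin M ↔ B → Fin (N * M) ↔ (A × B)
e ×ᵉ e′ = ↔-trans *↔× (e ×-↔ e′)

countIn-× : {P : Pred A 0ℓ} {Q : Pred B 0ℓ} (e : Fin N ↔ A) (e′ : Fin M ↔ B)
            (P? : Decidable P) (Q? : Decidable Q) →
            countIn (e ×ᵉ e′) (P? ×? Q?) ≡ countIn e P? * countIn e′ Q?
countIn-× e e′ P? Q? = count-× (P? ∘ Inverse.to e) (Q? ∘ Inverse.to e′)

countIn-partition : {P : Pred A 0ℓ} (e : Fin N ↔ A) (P? : Decidable P) (key : A → Fin K) →
                    countIn e P? ≡ ∑[ c < K ] countIn e (λ a → P? a ×-dec key a ≟ c)
countIn-partition e P? key = count-partition (P? ∘ Inverse.to e) (key ∘ Inverse.to e)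

∈⇒countIn-pos : {P : Pred A 0ℓ} (e : Fin N ↔ A) (P? : Decidable P) {a : A} → P a → 0 < countIn e P?
∈⇒countIn-pos {P = P} e P? {a} p =
  ∈⇒count-pos (P? ∘ Inverse.to e) (subst P (sym (Inverse.strictlyInverseˡ e a)) p)

countIn-pos⇒∃ : {P : Pred A 0ℓ} (e : Fin N ↔ A) (P? : Decidable P) → 0 < countIn e P? → ∃ P
countIn-pos⇒∃ e P? pos = Σ.map (Inverse.to e) id (count-pos⇒∃ (P? ∘ Inverse.to e) pos)

vecEnumeration : ∀ x n → Fin (x ℕ.^ n) ↔ Vec (Fin x) n
vecEnumeration x zero    = mk↔ₛ′ (λ _ → []) (λ _ → zero) (λ { [] → refl }) (λ { zero → refl })
vecEnumeration x (suc n) = ↔-trans (↔-refl ×ᵉ vecEnumeration x n)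
  (mk↔ₛ′ (uncurry _∷_) (λ v → head v , tail v) (λ { (a ∷ v) → refl }) (λ _ → refl))

lookup-≗⇒≡ : (v w : Vec A n) → lookup v ≗ lookup w → v ≡ w
lookup-≗⇒≡ v w v≗w = begin
  v                    ≡⟨ tabulate∘lookup v ⟨
  tabulate (lookup v)  ≡⟨ tabulate-cong v≗w ⟩
  tabulate (lookup w)  ≡⟨ tabulate∘lookup w ⟩
  w                    ∎
  where open ≡-Reasoning

-- Homomorphism counts

-- Maps between carriers are vectors rather than functions: they are enumerated by
-- vecEnumeration, and pointwise equal maps are equal without function extensionality.
Map : FDDS → FDDS → Set
Map D X = Vec (Fin (size X)) (size D)

IsHom : (D X : FDDS) → Pred (Map D X) 0ℓ
IsHom D X h = ∀ i → lookup h (map D i) ≡ map X (lookup h i)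

isHom? : (D X : FDDS) → Decidable (IsHom D X)
isHom? D X h = all? (λ i → lookup h (map D i) ≟ map X (lookup h i))

mapEnumeration : (D X : FDDS) → Fin (size X ℕ.^ size D) ↔ Map D X
mapEnumeration D X = vecEnumeration (size X) (size D)

homCount : FDDS → FDDS → ℕ
homCount D X = countIn (mapEnumeration D X) (isHom? D X)

IsHom-map : ∀ {D X Y} (φ : Fin (size X) → Fin (size Y)) → (∀ a → φ (map X a) ≡ map Y (φ a)) →
            ∀ {h} → IsHom D X h → IsHom D Y (Vec.map φ h)
IsHom-map {D} {X} {Y} φ φ-commute {h} h-hom i = begin
  lookup (Vec.map φ h) (map D i)  ≡⟨ lookup-map (map D i) φ h ⟩
  φ (lookup h (map D i))          ≡⟨ cong φ (h-hom i) ⟩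
  φ (map X (lookup h i))          ≡⟨ φ-commute (lookup h i) ⟩
  map Y (φ (lookup h i))          ≡⟨ cong (map Y) (lookup-map i φ h) ⟨
  map Y (lookup (Vec.map φ h) i)  ∎
  where open ≡-Reasoning

≅-from-commute : ∀ {X Y} (X≅Y : X ≅ Y) y → _≅_.from X≅Y (map Y y) ≡ map X (_≅_.from X≅Y y)
≅-from-commute {X} {Y} X≅Y y = begin
  from (map Y y)             ≡⟨ cong (from ∘ map Y) (to∘from y) ⟨
  from (map Y (to (from y))) ≡⟨ cong from (commute (from y)) ⟨
  from (to (map X (from y))) ≡⟨ from∘to (map X (from y)) ⟩
  map X (from y)             ∎
  where
  open ≡-Reasoning
  open _≅_ X≅Y

homCount-cong : ∀ D {X Y} → X ≅ Y → homCount D X ≡ homCount D Y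
homCount-cong D {X} {Y} X≅Y =
  countIn-↔ₚ (mapEnumeration D X) (mapEnumeration D Y) (isHom? D X) (isHom? D Y) (record
    { to      = Vec.map to
    ; from    = Vec.map from
    ; to-∈    = λ {h} → IsHom-map {D} {X} {Y} to commute {h}
    ; from-∈  = λ {h} → IsHom-map {D} {Y} {X} from (≅-from-commute X≅Y) {h}
    ; from∘to = λ {h} _ → map-inverse from∘to h
    ; to∘from = λ {h} _ → map-inverse to∘from h
    })
  where
  open _≅_ X≅Y
  map-inverse : {f : A → B} {g : B → A} → (∀ a → g (f a) ≡ a) →
                (v : Vec A n) → Vec.map g (Vec.map f v) ≡ v
  map-inverse {f = f} {g} g∘f v = trans (sym (map-∘ g f v)) (trans (map-cong g∘f v) (map-id v))

module _ (D X Y : FDDS) where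

  private
    π₁ : Fin (size (X ⊗ Y)) → Fin (size X)
    π₁ = proj₁ ∘ remQuot {size X} (size Y)

    π₂ : Fin (size (X ⊗ Y)) → Fin (size Y)
    π₂ = proj₂ ∘ remQuot {size X} (size Y)

    pair : Map D X × Map D Y → Map D (X ⊗ Y)
    pair (a , b) = Vec.zipWith combine a b

    unpair : Map D (X ⊗ Y) → Map D X × Map D Y
    unpair h = Vec.map π₁ h , Vec.map π₂ h

    lookup-pair : ∀ a b i → lookup (pair (a , b)) i ≡ combine (lookup a i) (lookup b i)
    lookup-pair a b i = lookup-zipWith combine i a b

    π₁-commute : ∀ z → π₁ (map (X ⊗ Y) z) ≡ map X (π₁ z)
    π₁-commute z = cong proj₁ (remQuot-combine (map X (π₁ z)) (map Y (π₂ z)))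

    π₂-commute : ∀ z → π₂ (map (X ⊗ Y) z) ≡ map Y (π₂ z)
    π₂-commute z = cong proj₂ (remQuot-combine (map X (π₁ z)) (map Y (π₂ z)))

    combine-commute : ∀ a b → map (X ⊗ Y) (combine a b) ≡ combine (map X a) (map Y b)
    combine-commute a b = cong (λ (a′ , b′) → combine (map X a′) (map Y b′)) (remQuot-combine a b)

    pair-hom : ∀ {a b} → IsHom D X a → IsHom D Y b → IsHom D (X ⊗ Y) (pair (a , b))
    pair-hom {a} {b} a-hom b-hom i = begin
      lookup (pair (a , b)) (map D i)                   ≡⟨ lookup-pair a b (map D i) ⟩
      combine (lookup a (map D i)) (lookup b (map D i)) ≡⟨ cong₂ combine (a-hom i) (b-hom i) ⟩
      combine (map X (lookup a i)) (map Y (lookup b i)) ≡⟨ combine-commute (lookup a i) (lookup b i) ⟨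
      map (X ⊗ Y) (combine (lookup a i) (lookup b i))   ≡⟨ cong (map (X ⊗ Y)) (lookup-pair a b i) ⟨
      map (X ⊗ Y) (lookup (pair (a , b)) i)             ∎
      where open ≡-Reasoning

    pair-unpair : ∀ h → pair (unpair h) ≡ h
    pair-unpair h = lookup-≗⇒≡ _ h λ i → begin
      lookup (pair (unpair h)) i
        ≡⟨ lookup-pair (Vec.map π₁ h) (Vec.map π₂ h) i ⟩
      combine (lookup (Vec.map π₁ h) i) (lookup (Vec.map π₂ h) i)
        ≡⟨ cong₂ combine (lookup-map i π₁ h) (lookup-map i π₂ h) ⟩
      combine (π₁ (lookup h i)) (π₂ (lookup h i))
        ≡⟨ combine-remQuot {size X} (size Y) (lookup h i) ⟩
      lookup h i
        ∎
      where open ≡-Reasoning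

    unpair-pair : ∀ a b → unpair (pair (a , b)) ≡ (a , b)
    unpair-pair a b = cong₂ _,_
      (lookup-≗⇒≡ _ a λ i → trans (lookup-map i π₁ (pair (a , b))) (cong proj₁ (remQuot-pair i)))
      (lookup-≗⇒≡ _ b λ i → trans (lookup-map i π₂ (pair (a , b))) (cong proj₂ (remQuot-pair i)))
      where
      remQuot-pair : ∀ i → remQuot (size Y) (lookup (pair (a , b)) i) ≡ (lookup a i , lookup b i)
      remQuot-pair i =
        trans (cong (remQuot (size Y)) (lookup-pair a b i)) (remQuot-combine (lookup a i) (lookup b i))

  homCount-⊗ : homCount D (X ⊗ Y) ≡ homCount D X * homCount D Y
  homCount-⊗ = trans
    (countIn-↔ₚ (mapEnumeration D (X ⊗ Y)) (mapEnumeration D X ×ᵉ mapEnumeration D Y)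
                (isHom? D (X ⊗ Y)) (isHom? D X ×? isHom? D Y) (record
      { to      = unpair
      ; from    = pair
      ; to-∈    = λ {h} h-hom → IsHom-map {D} {X ⊗ Y} {X} π₁ π₁-commute {h} h-hom
                              , IsHom-map {D} {X ⊗ Y} {Y} π₂ π₂-commute {h} h-hom
      ; from-∈  = λ {(a , b)} (a-hom , b-hom) → pair-hom {a} {b} a-hom b-hom
      ; from∘to = λ {h} _ → pair-unpair h
      ; to∘from = λ {(a , b)} _ → unpair-pair a b
      }))
    (countIn-× (mapEnumeration D X) (mapEnumeration D Y) (isHom? D X) (isHom? D Y))

homCount-𝟙 : ∀ D → homCount D 𝟙 ≡ 1
homCount-𝟙 D = trans (count-all (isHom? D 𝟙 ∘ Inverse.to (mapEnumeration D 𝟙)) (λ _ _ → Fin1-≡ _ _))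
                     (^-zeroˡ (size D))
  where
  Fin1-≡ : (a b : Fin 1) → a ≡ b
  Fin1-≡ zero zero = refl

homCount-^ : ∀ D X k → homCount D (X ^ k) ≡ homCount D X ℕ.^ k
homCount-^ D X zero    = homCount-𝟙 D
homCount-^ D X (suc k) = trans (homCount-⊗ D X (X ^ k)) (cong (homCount D X *_) (homCount-^ D X k))

-- Kernels

least : {P : Pred (Fin N) 0ℓ} → Decidable P → ∃ P →
        ∃ λ j → P j × (∀ {k} → P k → j ≤ᶠ k)
least {suc N} P? p with P? zero
... | yes p₀ = zero , p₀ , λ _ → z≤n
least {suc N} P? (zero , p)  | no ¬p₀ = ⊥-elim (¬p₀ p)
least {suc N} P? (suc i , p) | no ¬p₀ with least (P? ∘ suc) (i , p)
... | j , pj , j-least = suc j , pj , λ { {zero} p₀ → ⊥-elim (¬p₀ p₀) ; {suc k} pk → s≤s (j-least pk) }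

-- The kernel of H, encoded by sending each i to the least element of its fibre.
kernel : (Fin n → Fin x) → Fin n → Fin n
kernel H i = proj₁ (least (λ j → H j ≟ H i) (i , refl))

module _ (H : Fin n → Fin x) where

  kernel-sound : ∀ i → H (kernel H i) ≡ H i
  kernel-sound i = proj₁ (proj₂ (least (λ j → H j ≟ H i) (i , refl)))

  kernel-least : ∀ {i k} → H k ≡ H i → kernel H i ≤ᶠ k
  kernel-least {i} = proj₂ (proj₂ (least (λ j → H j ≟ H i) (i , refl)))

  kernel-cong : ∀ {i j} → H i ≡ H j → kernel H i ≡ kernel H j
  kernel-cong {i} {j} Hi≡Hj = ≤ᶠ-antisym
    (kernel-least (trans (kernel-sound j) (sym Hi≡Hj)))
    (kernel-least (trans (kernel-sound i) Hi≡Hj))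

kernel-unique : {H : Fin n → Fin x} (R : Fin n → Fin n) →
                (∀ i → R (R i) ≡ R i) → (∀ i → R i ≤ᶠ i) →
                (∀ {i j} → H i ≡ H j → R i ≡ R j) → (∀ {i j} → R i ≡ R j → H i ≡ H j) →
                ∀ i → kernel H i ≡ R i
kernel-unique {H = H} R R-idempotent R-below H⇒R R⇒H i = ≤ᶠ-antisym
  (kernel-least H (R⇒H (R-idempotent i)))
  (≤ᶠ-trans (≤ᶠ-reflexive (H⇒R (sym (kernel-sound H i)))) (R-below (kernel H i)))

record HasKernel (r : Vec (Fin n) n) (h : Vec (Fin x) n) : Set where
  constructor hasKernel
  field
    kernel-≡ : ∀ i → kernel (lookup h) i ≡ lookup r i

open HasKernel public

hasKernel? : (r : Vec (Fin n) n) → Decidable (HasKernel {x = x} r)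
hasKernel? r h = map′ hasKernel kernel-≡ (all? (λ i → kernel (lookup h) i ≟ lookup r i))

module _ {r : Vec (Fin n) n} {h : Vec (Fin x) n} (h-kernel : HasKernel r h) where

  hasKernel-sound : ∀ i → lookup h (lookup r i) ≡ lookup h i
  hasKernel-sound i = trans (cong (lookup h) (sym (kernel-≡ h-kernel i))) (kernel-sound (lookup h) i)

  hasKernel-complete : ∀ {i j} → lookup h i ≡ lookup h j → lookup r i ≡ lookup r j
  hasKernel-complete {i} {j} hi≡hj =
    trans (sym (kernel-≡ h-kernel i)) (trans (kernel-cong (lookup h) hi≡hj) (kernel-≡ h-kernel j))

hasKernel-allFin⇒injective : {h : Vec (Fin x) n} → HasKernel (allFin n) h →
                             Injective _≡_ _≡_ (lookup h)
hasKernel-allFin⇒injective h-kernel {i} {j} hi≡hj =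
  trans (sym (lookup-allFin i)) (trans (hasKernel-complete h-kernel hi≡hj) (lookup-allFin j))

injective⇒hasKernel-allFin : {h : Vec (Fin x) n} → Injective _≡_ _≡_ (lookup h) →
                             HasKernel (allFin n) h
injective⇒hasKernel-allFin {h = h} h-injective = hasKernel λ i →
  trans (h-injective (kernel-sound (lookup h) i)) (sym (lookup-allFin i))

-- R sends each state to the least element of its class for a congruence of D; congruences
-- correspond exactly to such R.
record IsCanonicalCongruence (D : FDDS) (R : Fin (size D) → Fin (size D)) : Set where
  field
    idempotent : ∀ i → R (R i) ≡ R i
    below      : ∀ i → R i ≤ᶠ i
    compatible : ∀ i → R (map D (R i)) ≡ R (map D i)

hasKernel-canonical : ∀ {D X h} {r : Vec (Fin (size D)) (size D)} → IsHom D X h → HasKernel r h →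
                      IsCanonicalCongruence D (lookup r)
hasKernel-canonical {D} {X} {h} {r} h-hom h-kernel = record
  { idempotent = λ i → hasKernel-complete h-kernel (hasKernel-sound h-kernel i)
  ; below      = λ i → subst (_≤ᶠ i) (kernel-≡ h-kernel i) (kernel-least (lookup h) refl)
  ; compatible = λ i → hasKernel-complete h-kernel (begin
      lookup h (map D (lookup r i)) ≡⟨ h-hom (lookup r i) ⟩
      map X (lookup h (lookup r i)) ≡⟨ cong (map X) (hasKernel-sound h-kernel i) ⟩
      map X (lookup h i)            ≡⟨ h-hom i ⟨
      lookup h (map D i)            ∎)
  }
  where open ≡-Reasoning

kernelCount : (D X : FDDS) → Vec (Fin (size D)) (size D) → ℕ
kernelCount D X r = countIn (mapEnumeration D X) (isHom? D X ∩? hasKernel? r)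

embeddingCount : FDDS → FDDS → ℕ
embeddingCount D X = kernelCount D X (allFin (size D))

kernelEnumeration : (D : FDDS) → Fin (size D ℕ.^ size D) ↔ Vec (Fin (size D)) (size D)
kernelEnumeration D = vecEnumeration (size D) (size D)

homCount-kernels : ∀ D X →
  homCount D X ≡ ∑[ c < size D ℕ.^ size D ] kernelCount D X (Inverse.to (kernelEnumeration D) c)
homCount-kernels D X = trans (countIn-partition (mapEnumeration D X) (isHom? D X) code) (sum-cong-≗ λ c →
  countIn-↔ₚ (mapEnumeration D X) (mapEnumeration D X)
    (λ h → isHom? D X h ×-dec code h ≟ c) (isHom? D X ∩? hasKernel? (to c)) (≐⇒↔ₚ
      ( (λ (h-hom , code≡c) → h-hom , code≡c⇒hasKernel code≡c)
      , (λ (h-hom , h-kernel) → h-hom , hasKernel⇒code≡c h-kernel))))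
  where
  open Inverse (kernelEnumeration D)
  code : Map D X → Fin (size D ℕ.^ size D)
  code h = from (tabulate (kernel (lookup h)))
  code≡c⇒hasKernel : ∀ {h c} → code h ≡ c → HasKernel (to c) h
  code≡c⇒hasKernel {h} {c} code≡c = hasKernel λ i → begin
    kernel (lookup h) i                     ≡⟨ lookup∘tabulate (kernel (lookup h)) i ⟨
    lookup (tabulate (kernel (lookup h))) i ≡⟨ cong (λ v → lookup v i) (strictlyInverseˡ _) ⟨
    lookup (to (code h)) i                  ≡⟨ cong (λ c′ → lookup (to c′) i) code≡c ⟩
    lookup (to c) i                         ∎
    where open ≡-Reasoning
  hasKernel⇒code≡c : ∀ {h c} → HasKernel (to c) h → code h ≡ c
  hasKernel⇒code≡c {h} {c} h-kernel = begin
    from (tabulate (kernel (lookup h))) ≡⟨ cong from (tabulate-cong (kernel-≡ h-kernel)) ⟩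
    from (tabulate (lookup (to c)))     ≡⟨ cong from (tabulate∘lookup (to c)) ⟩
    from (to c)                         ≡⟨ strictlyInverseʳ c ⟩
    c                                   ∎
    where open ≡-Reasoning

-- Quotients

module Quotient (D : FDDS) (r : Vec (Fin (size D)) (size D))
                (r-canonical : IsCanonicalCongruence D (lookup r)) where

  open IsCanonicalCongruence r-canonical

  R : Fin (size D) → Fin (size D)
  R = lookup r

  isRepresentative? : Decidable (λ i → R i ≡ i)
  isRepresentative? i = R i ≟ i

  Class : Set
  Class = Fin (count isRepresentative?)

  representative : Class → Fin (size D)
  representative = proj₁ ∘ element isRepresentative?

  class : Fin (size D) → Class
  class i = index isRepresentative? (R i) (idempotent i)

  representative-class : ∀ i → representative (class i) ≡ R i
  representative-class i = element-index isRepresentative? (R i) (idempotent i)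

  class-representative : ∀ c → class (representative c) ≡ c
  class-representative c = trans (index-cong isRepresentative? (proj₂ (element isRepresentative? c)))
                                 (index-element isRepresentative? c)

  class≡⇒R≡ : ∀ {i j} → class i ≡ class j → R i ≡ R j
  class≡⇒R≡ {i} {j} ci≡cj =
    trans (sym (representative-class i)) (trans (cong representative ci≡cj) (representative-class j))

  R≡⇒class≡ : ∀ {i j} → R i ≡ R j → class i ≡ class j
  R≡⇒class≡ = index-cong isRepresentative?

  quotient : FDDS
  quotient = mkFDDS (count isRepresentative?) (class ∘ map D ∘ representative)

  class-hom : ∀ i → class (map D i) ≡ map quotient (class i)
  class-hom i = R≡⇒class≡ (begin
    R (map D i)                          ≡⟨ compatible i ⟨
    R (map D (R i))                      ≡⟨ cong (R ∘ map D) (representative-class i) ⟨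
    R (map D (representative (class i))) ∎)
    where open ≡-Reasoning

  quotient-smaller : ¬ (∀ i → R i ≡ i) → size quotient < size D
  quotient-smaller = ¬∀⇒count<N isRepresentative?

  module _ (X : FDDS) where

    restrict : Map D X → Map quotient X
    restrict h = tabulate (lookup h ∘ representative)

    extend : Map quotient X → Map D X
    extend g = tabulate (lookup g ∘ class)

    lookup-restrict : ∀ h c → lookup (restrict h) c ≡ lookup h (representative c)
    lookup-restrict h = lookup∘tabulate (lookup h ∘ representative)

    lookup-extend : ∀ g i → lookup (extend g) i ≡ lookup g (class i)
    lookup-extend g = lookup∘tabulate (lookup g ∘ class)

    restrict-hom : ∀ {h} → IsHom D X h → HasKernel r h → IsHom quotient X (restrict h)
    restrict-hom {h} h-hom h-kernel c = begin
      lookup (restrict h) (map quotient c)        ≡⟨ lookup-restrict h (map quotient c) ⟩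
      lookup h (representative (map quotient c)) ≡⟨ cong (lookup h) (representative-class (map D i)) ⟩
      lookup h (R (map D i))                     ≡⟨ hasKernel-sound h-kernel (map D i) ⟩
      lookup h (map D i)                         ≡⟨ h-hom i ⟩
      map X (lookup h i)                         ≡⟨ cong (map X) (lookup-restrict h c) ⟨
      map X (lookup (restrict h) c)              ∎
      where
      open ≡-Reasoning
      i : Fin (size D)
      i = representative c

    restrict-injective : ∀ {h} → HasKernel r h → Injective _≡_ _≡_ (lookup (restrict h))
    restrict-injective {h} h-kernel {c} {c′} hc≡hc′ = begin
      c                               ≡⟨ class-representative c ⟨
      class (representative c)        ≡⟨ R≡⇒class≡ (hasKernel-complete h-kernel (begin
          lookup h (representative c)         ≡⟨ lookup-restrict h c ⟨
          lookup (restrict h) c               ≡⟨ hc≡hc′ ⟩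
          lookup (restrict h) c′              ≡⟨ lookup-restrict h c′ ⟩
          lookup h (representative c′)        ∎)) ⟩
      class (representative c′)       ≡⟨ class-representative c′ ⟩
      c′                              ∎
      where open ≡-Reasoning

    extend-hom : ∀ {g} → IsHom quotient X g → IsHom D X (extend g)
    extend-hom {g} g-hom i = begin
      lookup (extend g) (map D i)       ≡⟨ lookup-extend g (map D i) ⟩
      lookup g (class (map D i))        ≡⟨ cong (lookup g) (class-hom i) ⟩
      lookup g (map quotient (class i)) ≡⟨ g-hom (class i) ⟩
      map X (lookup g (class i))        ≡⟨ cong (map X) (lookup-extend g i) ⟨
      map X (lookup (extend g) i)       ∎
      where open ≡-Reasoning

    extend-kernel : ∀ {g} → Injective _≡_ _≡_ (lookup g) → HasKernel r (extend g)
    extend-kernel {g} g-injective = hasKernel (kernel-unique R idempotent below extend≡⇒R≡ R≡⇒extend≡)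
      where
      extend≡⇒R≡ : ∀ {i j} → lookup (extend g) i ≡ lookup (extend g) j → R i ≡ R j
      extend≡⇒R≡ {i} {j} e =
        class≡⇒R≡ (g-injective (trans (sym (lookup-extend g i)) (trans e (lookup-extend g j))))
      R≡⇒extend≡ : ∀ {i j} → R i ≡ R j → lookup (extend g) i ≡ lookup (extend g) j
      R≡⇒extend≡ {i} {j} Ri≡Rj =
        trans (lookup-extend g i) (trans (cong (lookup g) (R≡⇒class≡ Ri≡Rj)) (sym (lookup-extend g j)))

    restrict-extend : ∀ g → restrict (extend g) ≡ g
    restrict-extend g = lookup-≗⇒≡ _ g λ c → begin
      lookup (restrict (extend g)) c          ≡⟨ lookup-restrict (extend g) c ⟩
      lookup (extend g) (representative c)    ≡⟨ lookup-extend g (representative c) ⟩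
      lookup g (class (representative c))     ≡⟨ cong (lookup g) (class-representative c) ⟩
      lookup g c                              ∎
      where open ≡-Reasoning

    extend-restrict : ∀ {h} → HasKernel r h → extend (restrict h) ≡ h
    extend-restrict {h} h-kernel = lookup-≗⇒≡ _ h λ i → begin
      lookup (extend (restrict h)) i          ≡⟨ lookup-extend (restrict h) i ⟩
      lookup (restrict h) (class i)           ≡⟨ lookup-restrict h (class i) ⟩
      lookup h (representative (class i))     ≡⟨ cong (lookup h) (representative-class i) ⟩
      lookup h (R i)                          ≡⟨ hasKernel-sound h-kernel i ⟩
      lookup h i                              ∎
      where open ≡-Reasoning

    kernelCount-quotient : kernelCount D X r ≡ embeddingCount quotient X
    kernelCount-quotient = countIn-↔ₚ (mapEnumeration D X) (mapEnumeration quotient X)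
      (isHom? D X ∩? hasKernel? r) (isHom? quotient X ∩? hasKernel? (allFin (size quotient))) (record
      { to      = restrict
      ; from    = extend
      ; to-∈    = λ (h-hom , h-kernel) →
                    restrict-hom h-hom h-kernel , injective⇒hasKernel-allFin (restrict-injective h-kernel)
      ; from-∈  = λ {g} (g-hom , g-embedding) →
                    extend-hom {g} g-hom , extend-kernel {g} (hasKernel-allFin⇒injective g-embedding)
      ; from∘to = λ (_ , h-kernel) → extend-restrict h-kernel
      ; to∘from = λ _ → restrict-extend _
      })

-- Homomorphism counts determine an FDDS

injective⇒surjective : {f : Fin N → Fin M} → Injective _≡_ _≡_ f → M ≤ N →
                       ∀ b → ∃ λ a → f a ≡ b
injective⇒surjective {N} {suc M} {f} f-injective M≤N b with any? (λ a → f a ≟ b)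
... | yes found = found
... | no  missed = contradiction (≤-trans M≤N (injective⇒≤ g-injective)) 1+n≰n
  where
  g : Fin N → Fin M
  g a = punchOut {i = b} {j = f a} (λ b≡fa → missed (a , sym b≡fa))
  g-injective : Injective _≡_ _≡_ g
  g-injective ga≡ga′ = f-injective (punchOut-injective {i = b} _ _ ga≡ga′)

injective-hom⇒≅ : ∀ {X Y} {t : Map X Y} → IsHom X Y t → Injective _≡_ _≡_ (lookup t) →
                  size Y ≤ size X → X ≅ Y
injective-hom⇒≅ {t = t} t-hom t-injective Y≤X = record
  { to      = lookup t
  ; from    = λ y → proj₁ (onto y)
  ; from∘to = λ x → t-injective (proj₂ (onto (lookup t x)))
  ; to∘from = λ y → proj₂ (onto y)
  ; commute = t-hom
  }
  where
  onto : ∀ y → ∃ λ x → lookup t x ≡ y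
  onto = injective⇒surjective t-injective Y≤X

embeddingCount-self-pos : ∀ X → 0 < embeddingCount X X
embeddingCount-self-pos X = ∈⇒countIn-pos (mapEnumeration X X) (isHom? X X ∩? hasKernel? (allFin (size X)))
  {allFin (size X)} (identity-hom , injective⇒hasKernel-allFin identity-injective)
  where
  identity-hom : IsHom X X (allFin (size X))
  identity-hom i = trans (lookup-allFin (map X i)) (cong (map X) (sym (lookup-allFin i)))
  identity-injective : Injective _≡_ _≡_ (lookup (allFin (size X)))
  identity-injective {i} {j} e = trans (sym (lookup-allFin i)) (trans e (lookup-allFin j))

embedding-exists : ∀ A B → embeddingCount A A ≡ embeddingCount A B →
                   ∃ λ h → IsHom A B h × Injective _≡_ _≡_ (lookup h)
embedding-exists A B e with countIn-pos⇒∃ (mapEnumeration A B) (isHom? A B ∩? hasKernel? (allFin (size A)))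
                                          (subst (0 <_) e (embeddingCount-self-pos A))
... | h , h-hom , h-kernel = h , h-hom , hasKernel-allFin⇒injective h-kernel

kernelCount-nonzero⇒canonical : ∀ D Z r → kernelCount D Z r ≢ 0 → IsCanonicalCongruence D (lookup r)
kernelCount-nonzero⇒canonical D Z r count≢0
  with countIn-pos⇒∃ (mapEnumeration D Z) (isHom? D Z ∩? hasKernel? r) (n≢0⇒n>0 count≢0)
... | h , h-hom , h-kernel = hasKernel-canonical {X = Z} h-hom h-kernel

module _ {X Y : FDDS} (homCount-≡ : ∀ D → homCount D X ≡ homCount D Y) where

  module _ (D : FDDS) (IH : ∀ Q → size Q < size D → embeddingCount Q X ≡ embeddingCount Q Y)
           (r : Vec (Fin (size D)) (size D)) (r≢id : ¬ (∀ i → lookup r i ≡ i)) where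

    kernelCount-via-quotient : IsCanonicalCongruence D (lookup r) → kernelCount D X r ≡ kernelCount D Y r
    kernelCount-via-quotient r-canonical = begin
      kernelCount D X r           ≡⟨ kernelCount-quotient X ⟩
      embeddingCount quotient X   ≡⟨ IH quotient (quotient-smaller r≢id) ⟩
      embeddingCount quotient Y   ≡⟨ kernelCount-quotient Y ⟨
      kernelCount D Y r           ∎
      where
      open ≡-Reasoning
      open Quotient D r r-canonical

    kernelCount-agree : kernelCount D X r ≡ kernelCount D Y r
    kernelCount-agree with kernelCount D X r ≟ℕ 0 | kernelCount D Y r ≟ℕ 0
    ... | yes X≡0 | yes Y≡0 = trans X≡0 (sym Y≡0)
    ... | no  X≢0 | _       = kernelCount-via-quotient (kernelCount-nonzero⇒canonical D X r X≢0)
    ... | _       | no  Y≢0 = kernelCount-via-quotient (kernelCount-nonzero⇒canonical D Y r Y≢0)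

  embeddingCount-agree : ∀ D → embeddingCount D X ≡ embeddingCount D Y
  embeddingCount-agree D = go D (<-wellFounded (size D))
    where
    go : ∀ D → Acc _<_ (size D) → embeddingCount D X ≡ embeddingCount D Y
    go D (acc smaller) =
      subst (λ r → kernelCount D X r ≡ kernelCount D Y r) (strictlyInverseˡ (allFin (size D)))
        (sum-cancel-except (kernelCount D X ∘ to) (kernelCount D Y ∘ to) identity
                           other-kernels-agree kernel-sums-agree)
      where
      open ≡-Reasoning
      open Inverse (kernelEnumeration D)
      identity : Fin (size D ℕ.^ size D)
      identity = from (allFin (size D))
      kernel-sums-agree : sum (kernelCount D X ∘ to) ≡ sum (kernelCount D Y ∘ to)
      kernel-sums-agree = trans (sym (homCount-kernels D X)) (trans (homCount-≡ D) (homCount-kernels D Y))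
      ≗id⇒identity : ∀ c → (∀ i → lookup (to c) i ≡ i) → c ≡ identity
      ≗id⇒identity c to-c≗id = begin
        c            ≡⟨ strictlyInverseʳ c ⟨
        from (to c)  ≡⟨ cong from (lookup-≗⇒≡ (to c) _ λ i → trans (to-c≗id i) (sym (lookup-allFin i))) ⟩
        identity     ∎
      other-kernels-agree : ∀ c → c ≢ identity → kernelCount D X (to c) ≡ kernelCount D Y (to c)
      other-kernels-agree c c≢identity =
        kernelCount-agree D (λ Q Q<D → go Q (smaller Q<D)) (to c) (c≢identity ∘ ≗id⇒identity c)

  homCount-≡⇒≅ : X ≅ Y
  homCount-≡⇒≅ =
    let (t , t-hom , t-injective) = embedding-exists X Y (embeddingCount-agree X)
        (_ , _ , s-injective)     = embedding-exists Y X (sym (embeddingCount-agree Y))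
    in  injective-hom⇒≅ {X} {Y} {t} t-hom t-injective (injective⇒≤ s-injective)

-- Injectivity of monomials

^-cancelʳ-≡ : ∀ {m n} k .{{_ : NonZero k}} → m ℕ.^ k ≡ n ℕ.^ k → m ≡ n
^-cancelʳ-≡ {m} {n} k mᵏ≡nᵏ with <-cmp m n
... | tri< m<n _ _ = contradiction mᵏ≡nᵏ (<⇒≢ (^-monoˡ-< k m<n))
... | tri≈ _ m≡n _ = m≡n
... | tri> _ _ m>n = contradiction (sym mᵏ≡nᵏ) (<⇒≢ (^-monoˡ-< k m>n))

*-cong-^ : ∀ a {b c} k → a * b ≡ a * c → a * b ℕ.^ k ≡ a * c ℕ.^ k
*-cong-^ zero    k _     = refl
*-cong-^ (suc a) {b} {c} k ab≡ac = cong (λ x → suc a * x ℕ.^ k) (*-cancelˡ-≡ b c (suc a) ab≡ac)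

^-injective : ∀ {X Y} k .{{_ : NonZero k}} → (X ^ k) ≅ (Y ^ k) → X ≅ Y
^-injective {X} {Y} k Xᵏ≅Yᵏ = homCount-≡⇒≅ λ D → ^-cancelʳ-≡ k (begin
  homCount D X ℕ.^ k   ≡⟨ homCount-^ D X k ⟨
  homCount D (X ^ k)   ≡⟨ homCount-cong D Xᵏ≅Yᵏ ⟩
  homCount D (Y ^ k)   ≡⟨ homCount-^ D Y k ⟩
  homCount D Y ℕ.^ k   ∎)
  where open ≡-Reasoning

⊗-cong-^ : ∀ A B C k → (A ⊗ B) ≅ (A ⊗ C) → (A ⊗ (B ^ k)) ≅ (A ⊗ (C ^ k))
⊗-cong-^ A B C k AB≅AC = homCount-≡⇒≅ λ D → begin
  homCount D (A ⊗ (B ^ k))           ≡⟨ homCount-monomial D B ⟩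
  homCount D A * homCount D B ℕ.^ k  ≡⟨ *-cong-^ (homCount D A) k (begin
      homCount D A * homCount D B        ≡⟨ homCount-⊗ D A B ⟨
      homCount D (A ⊗ B)                 ≡⟨ homCount-cong D AB≅AC ⟩
      homCount D (A ⊗ C)                 ≡⟨ homCount-⊗ D A C ⟩
      homCount D A * homCount D C        ∎) ⟩
  homCount D A * homCount D C ℕ.^ k  ≡⟨ homCount-monomial D C ⟨
  homCount D (A ⊗ (C ^ k))           ∎
  where
  open ≡-Reasoning
  homCount-monomial : ∀ D Z → homCount D (A ⊗ (Z ^ k)) ≡ homCount D A * homCount D Z ℕ.^ k
  homCount-monomial D Z = trans (homCount-⊗ D A (Z ^ k)) (cong (homCount D A *_) (homCount-^ D Z k))

proposition4 : (A : FDDS) (k : ℕ) → k ≥ 1 →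
    ((∀ (X Y : FDDS) → (A ⊗ (X ^ k)) ≅ (A ⊗ (Y ^ k)) → X ≅ Y) → Cancelable A)
    × (Cancelable A → ∀ (X Y : FDDS) → (A ⊗ (X ^ k)) ≅ (A ⊗ (Y ^ k)) → X ≅ Y)
proposition4 A k k≥1 = injective⇒cancelable , cancelable⇒injective
  where
  instance
    k-nonZero : NonZero k
    k-nonZero = >-nonZero k≥1
  injective⇒cancelable : (∀ X Y → (A ⊗ (X ^ k)) ≅ (A ⊗ (Y ^ k)) → X ≅ Y) → Cancelable A
  injective⇒cancelable injective B C AB≅AC = injective B C (⊗-cong-^ A B C k AB≅AC)
  cancelable⇒injective : Cancelable A → ∀ X Y → (A ⊗ (X ^ k)) ≅ (A ⊗ (Y ^ k)) → X ≅ Y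
  cancelable⇒injective cancelable X Y AXᵏ≅AYᵏ = ^-injective k (cancelable (X ^ k) (Y ^ k) AXᵏ≅AYᵏ)
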